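{- Let $N$ be an evolutionary network containing a hybrid node $h$ and two non-trivial paths $v_1\rightsquigarrow h$ and $v_2\rightsquigarrow h$ that have only their end $h$ in common. Then either both $v_1$ and $v_2$ are intermediate nodes of a reticulation cycle for $h$, or one of the nodes $v_1,v_2$ is an intermediate node of a reticulation cycle for $h$ whose split node is a descendant of the other node.
   Context: An evolutionary network on a set $S$ of taxa is a rooted directed acyclic graph whose leaves are bijectively labeled by $S$. A tree node is a node of in-degree at most 1; a hybrid node is a node of in-degree at least 2. $u\rightsquigarrow v$ denotes a directed path from $u$ to $v$; it is non-trivial if $u\neq v$. If there is a path $u\rightsquigarrow v$, $v$ is a descendant of $u$ (and $u$ an ancestor of $v$). Two paths are internally disjoint if their sets of intermediate (non-endpoint) nodes are disjoint. A reticulation cycle for a hybrid node $h$ is a pair of internally disjoint (distinct, non-trivial) paths with the same origin and both ending in $h$; each path is a merge path, the common origin is the split node, $h$ is the end, and the intermediate nodes of the reticulation cycle are the intermediate nodes of its two merge paths. -}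

module Defs where

open import Data.Nat using (ℕ; _≥_)
open import Data.Fin using (Fin)
open import Data.Bool using (Bool; T)
open import Data.List using (List; []; _∷_; _++_; [_]; length; filterᵇ; allFin)
open import Data.List.Membership.Propositional using (_∈_; _∉_)
open import Data.Product using (Σ; ∃; _×_; _,_)
open import Data.Sum using (_⊎_)
open import Relation.Binary.PropositionalEquality using (_≡_; _≢_)
open import Relation.Nullary using (¬_)
open import Function.Bundles using (_↔_)

module _ {n : ℕ} (adj : Fin n → Fin n → Bool) where

  data Path : Fin n → Fin n → Set where
    stop : (v : Fin n) → Path v v
    step : ∀ {u w v} → T (adj u w) → Path w v → Path u v

  -- a path u ⇝ v is non-trivial if it has at least one arc (u ≠ v in a DAG)
  NonTrivial : ∀ {u v} → Path u v → Set
  NonTrivial (stop _) = ⊥' where open import Data.Empty renaming (⊥ to ⊥')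
  NonTrivial (step _ _) = ⊤' where open import Data.Unit renaming (⊤ to ⊤')

  initNodes : ∀ {u v} → Path u v → List (Fin n)
  initNodes (stop _) = []
  initNodes (step {u} _ p) = u ∷ initNodes p

  nodes : ∀ {u v} → Path u v → List (Fin n)
  nodes {v = v} p = initNodes p ++ [ v ]

  interior : ∀ {u v} → Path u v → List (Fin n)
  interior (stop _) = []
  interior (step _ p) = initNodes p

  indeg : Fin n → ℕ
  indeg v = length (filterᵇ (λ u → adj u v) (allFin n))

  outdeg : Fin n → ℕ
  outdeg u = length (filterᵇ (λ v → adj u v) (allFin n))

record Network (S : Set) : Set₁ where
  field
    size    : ℕ
    adj     : Fin size → Fin size → Bool
    acyclic : ∀ v → (p : Path adj v v) → ¬ NonTrivial adj p
    root    : Fin size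
    root-indeg : indeg adj root ≡ 0
    rooted  : ∀ v → Path adj root v
    labelling : (Σ (Fin size) λ v → outdeg adj v ≡ 0) ↔ S

  Node : Set
  Node = Fin size

  Hybrid : Node → Set
  Hybrid v = indeg adj v ≥ 2

  _⇝_ : Node → Node → Set
  u ⇝ v = Path adj u v

  record RetCycle (h : Node) : Set where
    field
      split : Node
      path₁ : split ⇝ h
      path₂ : split ⇝ h
      nontriv₁ : NonTrivial adj path₁
      nontriv₂ : NonTrivial adj path₂
      distinct : path₁ ≢ path₂
      int-disjoint : ∀ x → x ∈ interior adj path₁ → x ∉ interior adj path₂

  Intermediate : ∀ {h} → Node → RetCycle h → Set
  Intermediate x C = x ∈ interior adj (RetCycle.path₁ C) ⊎ x ∈ interior adj (RetCycle.path₂ C)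

module Submission where

-- Let W be the path  root ⇝ v₂  (given by rootedness) followed
-- by p₂, a path root ⇝ h through v₂.  Walk along p₁ and look at the LAST
-- node x (before h) that lies on W.
--   * If such an x exists, it lies on the root-path part of W strictly
--     before v₂ (p₁ and p₂ share only h).  The rest of p₁ from x and the
--     rest of W from x are two internally disjoint paths x ⇝ h, a
--     reticulation cycle with split x containing v₂ as intermediate node,
--     and v₁ ⇝ x along p₁.
--   * Otherwise p₁ avoids W; take the last node x of W on the root path to
--     v₁.  The rest of that path followed by p₁ avoids W and contains v₁;
--     together with the rest of W from x it forms a reticulation cycle.
--     If x lies before v₂ on W, v₂ is intermediate too; if x lies on p₂,
--     then v₂ ⇝ x.

open import Defs
open import Data.List.Membership.Propositional using (_∈_)
open import Data.Product using (Σ; _×_)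
open import Data.Sum using (_⊎_)
open import Relation.Binary.PropositionalEquality using (_≡_)

open import Data.Nat using (ℕ)
open import Data.Fin using (Fin; _≟_)
open import Data.Bool using (Bool)
open import Data.List using (_∷_; _++_)
open import Data.List.Relation.Unary.Any using (here; there)
open import Data.List.Membership.Propositional.Properties using (∈-++⁺ˡ; ∈-++⁺ʳ; ∈-++⁻)
import Data.List.Membership.DecPropositional as DecMembership
open import Data.Product using (_,_)
open import Data.Sum using (inj₁; inj₂; [_,_]′)
open import Data.Empty using (⊥-elim)
open import Data.Unit using (tt)
open import Function using (id; _∘_)
open import Relation.Nullary using (¬_; yes; no)
open import Relation.Unary using (Decidable)
open import Relation.Binary.PropositionalEquality using (_≢_; refl; sym; subst; cong)

module Paths {n : ℕ} (adj : Fin n → Fin n → Bool) where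

  _++ₚ_ : ∀ {u w v} → Path adj u w → Path adj w v → Path adj u v
  stop _   ++ₚ q = q
  step e p ++ₚ q = step e (p ++ₚ q)

  initNodes-++ : ∀ {u w v} (p : Path adj u w) (q : Path adj w v) →
                 initNodes adj (p ++ₚ q) ≡ initNodes adj p ++ initNodes adj q
  initNodes-++ (stop _)       q = refl
  initNodes-++ (step {u} e p) q = cong (u ∷_) (initNodes-++ p q)

  interior-++ : ∀ {u w v} (p : Path adj u w) (q : Path adj w v) → NonTrivial adj p →
                interior adj (p ++ₚ q) ≡ interior adj p ++ initNodes adj q
  interior-++ (step e p) q _ = initNodes-++ p q

  ++-nontrivial : ∀ {u w v} (p : Path adj u w) {q : Path adj w v} →
                  NonTrivial adj q → NonTrivial adj (p ++ₚ q)
  ++-nontrivial (stop _)   nt = nt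
  ++-nontrivial (step e p) _  = tt

  interior⊆initNodes : ∀ {u v} (p : Path adj u v) {y} →
                       y ∈ interior adj p → y ∈ initNodes adj p
  interior⊆initNodes (step e p) m = there m

  start∈initNodes : ∀ {u v} (p : Path adj u v) → NonTrivial adj p → u ∈ initNodes adj p
  start∈initNodes (step e p) _ = here refl

  start-trivial-or-init : ∀ {u v} (p : Path adj u v) → u ≡ v ⊎ u ∈ initNodes adj p
  start-trivial-or-init (stop _)   = inj₁ refl
  start-trivial-or-init (step e p) = inj₂ (here refl)

  record Tail {u t} (w : Path adj u t) (x : Fin n) : Set where
    field
      path       : Path adj x t
      nontrivial : NonTrivial adj path
      along      : ∀ {y} → y ∈ initNodes adj path → y ∈ initNodes adj w

  retarget : ∀ {u u′ t x} {w : Path adj u t} {w′ : Path adj u′ t} →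
             (∀ {y} → y ∈ initNodes adj w → y ∈ initNodes adj w′) → Tail w x → Tail w′ x
  retarget w⊆w′ tail = record
    { path = Tail.path tail ; nontrivial = Tail.nontrivial tail ; along = w⊆w′ ∘ Tail.along tail }

  tailAt : ∀ {u t x} (w : Path adj u t) → x ∈ initNodes adj w → Path adj u x × Tail w x
  tailAt (step e w) (here refl) =
    stop _ , record { path = step e w ; nontrivial = tt ; along = id }
  tailAt (step e w) (there m) with tailAt w m
  ... | prefix , tail = step e prefix , retarget there tail

  tail-++ʳ : ∀ {u v t x} (q : Path adj u v) {p : Path adj v t} → Tail p x → Tail (q ++ₚ p) x
  tail-++ʳ q {p} = retarget λ m → subst (_ ∈_) (sym (initNodes-++ q p)) (∈-++⁺ʳ (initNodes adj q) m)

  tail-++ˡ : ∀ {u v t x} (q : Path adj u v) (p : Path adj v t) → NonTrivial adj p →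
             x ∈ initNodes adj q → Σ (Tail (q ++ₚ p) x) λ tail → v ∈ interior adj (Tail.path tail)
  tail-++ˡ q p ntp m with tailAt q m
  ... | _ , record { path = s ; nontrivial = nts ; along = s-along } =
    record { path = s ++ₚ p ; nontrivial = ++-nontrivial s ntp ; along = along }
    , subst (_ ∈_) (sym (interior-++ s p nts))
            (∈-++⁺ʳ (interior adj s) (start∈initNodes p ntp))
    where
    along : ∀ {y} → y ∈ initNodes adj (s ++ₚ p) → y ∈ initNodes adj (q ++ₚ p)
    along m′ rewrite initNodes-++ s p | initNodes-++ q p with ∈-++⁻ (initNodes adj s) m′
    ... | inj₁ in-s = ∈-++⁺ˡ (s-along in-s)
    ... | inj₂ in-p = ∈-++⁺ʳ (initNodes adj q) in-p

  module LastHit (P : Fin n → Set) (P? : Decidable P) where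

    record Hit {u t} (w : Path adj u t) : Set where
      field
        x          : Fin n
        Px         : P x
        x∈         : x ∈ initNodes adj w
        prefix     : Path adj u x
        suffix     : Path adj x t
        nontrivial : NonTrivial adj suffix
        avoids     : ∀ y → y ∈ interior adj suffix → ¬ P y

    lastHit : ∀ {u t} (w : Path adj u t) → (∀ y → y ∈ initNodes adj w → ¬ P y) ⊎ Hit w
    lastHit (stop _) = inj₁ λ y ()
    lastHit (step {u} e w) with lastHit w
    ... | inj₂ hit = inj₂ (record { x = x ; Px = Px ; x∈ = there x∈ ; prefix = step e prefix
                                  ; suffix = suffix ; nontrivial = nontrivial ; avoids = avoids })
      where open Hit hit
    ... | inj₁ none with P? u
    ...   | yes Pu = inj₂ (record { x = u ; Px = Pu ; x∈ = here refl ; prefix = stop u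
                                  ; suffix = step e w ; nontrivial = tt ; avoids = none })
    ...   | no ¬Pu = inj₁ λ { y (here refl) → ¬Pu ; y (there m) → none y m }

module Cycles {S : Set} (N : Network S) where
  open Network N
  open Paths adj

  nontrivial-≢ : ∀ {x y} (w : x ⇝ y) → NonTrivial adj w → x ≢ y
  nontrivial-≢ {x} w nt refl = acyclic x w nt

  -- A non-trivial path a : x ⇝ h avoiding the non-final nodes of a path
  -- w ⇝ h, and a tail of w from x, form a reticulation cycle with split x
  -- once one of them has an intermediate node z (this makes them distinct).
  cycleAlong : ∀ {u h x z} (w : u ⇝ h) (a : x ⇝ h) → NonTrivial adj a →
               (∀ y → y ∈ interior adj a → ¬ y ∈ initNodes adj w) → (tail : Paths.Tail adj w x) →
               z ∈ interior adj a ⊎ z ∈ interior adj (Tail.path tail) → RetCycle h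
  cycleAlong w a nta avoids tail witness = record
    { split = _ ; path₁ = a ; path₂ = Tail.path tail
    ; nontriv₁ = nta ; nontriv₂ = Tail.nontrivial tail
    ; distinct = distinct witness
    ; int-disjoint = disjoint }
    where
    disjoint : ∀ y → y ∈ interior adj a → ¬ y ∈ interior adj (Tail.path tail)
    disjoint y ya yb = avoids y ya (Tail.along tail (interior⊆initNodes (Tail.path tail) yb))

    distinct : _ → a ≢ Tail.path tail
    distinct (inj₁ za) refl = disjoint _ za za
    distinct (inj₂ zb) refl = disjoint _ zb zb

  Conclusion : (h v₁ v₂ : Node) → Set
  Conclusion h v₁ v₂ = (Σ (RetCycle h) λ C → Intermediate v₁ C × Intermediate v₂ C)
    ⊎ ((Σ (RetCycle h) λ C → Intermediate v₁ C × (v₂ ⇝ RetCycle.split C))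
    ⊎ (Σ (RetCycle h) λ C → Intermediate v₂ C × (v₁ ⇝ RetCycle.split C)))

  module Argument {h v₁ v₂ : Node} (p₁ : v₁ ⇝ h) (p₂ : v₂ ⇝ h)
                  (nt₁ : NonTrivial adj p₁) (nt₂ : NonTrivial adj p₂) where

    W : root ⇝ h
    W = rooted v₂ ++ₚ p₂

    OnW : Node → Set
    OnW y = y ∈ initNodes adj W

    open LastHit OnW (λ y → DecMembership._∈?_ (_≟_ {size}) y (initNodes adj W)) public

    root∈W : OnW root
    root∈W = start∈initNodes W (++-nontrivial (rooted v₂) nt₂)

    onW-cases : ∀ {x} → OnW x → x ∈ initNodes adj (rooted v₂) ⊎ x ∈ initNodes adj p₂
    onW-cases m = ∈-++⁻ (initNodes adj (rooted v₂)) (subst (_ ∈_) (initNodes-++ (rooted v₂) p₂) m)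

    -- p₁ meets W: the last meeting point x precedes v₂ on W, since p₁ and
    -- p₂ share only h and x ≠ h.
    crossing : (∀ x → x ∈ nodes adj p₁ → x ∈ nodes adj p₂ → x ≡ h) → Hit p₁ → Conclusion h v₁ v₂
    crossing disjoint hit = finish (onW-cases Px)
      where
      open Hit hit
      finish : x ∈ initNodes adj (rooted v₂) ⊎ x ∈ initNodes adj p₂ → Conclusion h v₁ v₂
      finish (inj₁ before-v₂) =
        let tail , v₂∈tail = tail-++ˡ (rooted v₂) p₂ nt₂ before-v₂
        in inj₂ (inj₂ (cycleAlong W suffix nontrivial avoids tail (inj₂ v₂∈tail) , inj₂ v₂∈tail , prefix))
      finish (inj₂ on-p₂) =
        ⊥-elim (nontrivial-≢ suffix nontrivial (disjoint x (∈-++⁺ˡ x∈) (∈-++⁺ˡ on-p₂)))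

    -- p₁ avoids W: use the last node x of W on the root path to v₁; it
    -- exists because the root lies on W (and v₁, the start of p₁, does not).
    avoiding : (∀ y → y ∈ initNodes adj p₁ → ¬ OnW y) → Conclusion h v₁ v₂
    avoiding p₁-avoids with lastHit (rooted v₁)
    ... | inj₁ none with start-trivial-or-init (rooted v₁)
    ...   | inj₁ refl = ⊥-elim (p₁-avoids v₁ (start∈initNodes p₁ nt₁) root∈W)
    ...   | inj₂ root∈ = ⊥-elim (none root root∈ root∈W)
    avoiding p₁-avoids | inj₂ hit = finish (onW-cases Px)
      where
      open Hit hit
      a : x ⇝ h
      a = suffix ++ₚ p₁

      a-nontrivial : NonTrivial adj a
      a-nontrivial = ++-nontrivial suffix nt₁

      a-avoids : ∀ y → y ∈ interior adj a → ¬ OnW y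
      a-avoids y m with ∈-++⁻ (interior adj suffix) (subst (_ ∈_) (interior-++ suffix p₁ nontrivial) m)
      ... | inj₁ in-suffix = avoids y in-suffix
      ... | inj₂ in-p₁     = p₁-avoids y in-p₁

      v₁∈a : v₁ ∈ interior adj a
      v₁∈a = subst (_ ∈_) (sym (interior-++ suffix p₁ nontrivial))
                   (∈-++⁺ʳ (interior adj suffix) (start∈initNodes p₁ nt₁))

      finish : x ∈ initNodes adj (rooted v₂) ⊎ x ∈ initNodes adj p₂ → Conclusion h v₁ v₂
      finish (inj₁ before-v₂) =
        let tail , v₂∈tail = tail-++ˡ (rooted v₂) p₂ nt₂ before-v₂
        in inj₁ (cycleAlong W a a-nontrivial a-avoids tail (inj₁ v₁∈a) , inj₁ v₁∈a , inj₂ v₂∈tail)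
      finish (inj₂ on-p₂) =
        let v₂⇝x , tail = tailAt p₂ on-p₂
        in inj₂ (inj₁ (cycleAlong W a a-nontrivial a-avoids (tail-++ʳ (rooted v₂) tail) (inj₁ v₁∈a)
                       , inj₁ v₁∈a , v₂⇝x))

lemma1 : {S : Set} (N : Network S) → let open Network N in
    (h v₁ v₂ : Node) → Hybrid h →
    (p₁ : v₁ ⇝ h) → (p₂ : v₂ ⇝ h) → NonTrivial adj p₁ → NonTrivial adj p₂ →
    (∀ x → x ∈ nodes adj p₁ → x ∈ nodes adj p₂ → x ≡ h) →
    (Σ (RetCycle h) λ C → Intermediate v₁ C × Intermediate v₂ C)
    ⊎ ((Σ (RetCycle h) λ C → Intermediate v₁ C × (v₂ ⇝ RetCycle.split C))
    ⊎ (Σ (RetCycle h) λ C → Intermediate v₂ C × (v₁ ⇝ RetCycle.split C)))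
lemma1 N h v₁ v₂ _ p₁ p₂ nt₁ nt₂ disjoint =
  [ avoiding , crossing disjoint ]′ (lastHit p₁)
  where open Cycles.Argument N p₁ p₂ nt₁ nt₂
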